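{- Let $\mathbf L=(L,\vee,\wedge,0,1)$ be a complemented modular lattice and $\Phi$ a congruence of the meet-semilattice $(L,\wedge)$. Then: (i) $[1]\Phi$ is a deductive system of $\mathbf L$; (ii) $\Theta([1]\Phi)\subseteq\Phi$.
   Context: A bounded lattice is complemented if every element $a$ has some $b$ with $a\vee b=1$, $a\wedge b=0$ (complements need not be unique); lattices are non-trivial. For $a\in L$, $a^+:=\{x\in L\mid a\vee x=1,\ a\wedge x=0\}$, and $a\to b:=\{x\vee(a\wedge b)\mid x\in a^+\}$. A deductive system of $\mathbf L$ is a subset $D\subseteq L$ with $1\in D$ such that whenever $a\in D$, $b\in L$ and $a\to b\subseteq D$, then $b\in D$. For a deductive system $D$, $\Theta(D):=\{(x,y)\in L^2\mid x\to y\subseteq D\text{ and }y\to x\subseteq D\}$. $[1]\Phi$ denotes the $\Phi$-class of $1$. -}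

module Defs where

open import Level using (Level; suc; _⊔_)
open import Data.Product using (Σ; ∃; _×_; _,_)
open import Relation.Nullary using (¬_)
open import Relation.Unary using (Pred; _⊆_)
open import Relation.Binary using (Rel; IsEquivalence)
open import Relation.Binary.PropositionalEquality using (_≡_)
open import Algebra.Lattice.Structures using (IsLattice)

record BoundedLattice (a : Level) : Set (suc a) where
  infixr 6 _∨_
  infixr 7 _∧_
  field
    Carrier   : Set a
    _∨_       : Carrier → Carrier → Carrier
    _∧_       : Carrier → Carrier → Carrier
    𝟘         : Carrier
    𝟙         : Carrier
    isLattice : IsLattice _≡_ _∨_ _∧_
    ∨-𝟘       : ∀ x → x ∨ 𝟘 ≡ x
    ∧-𝟙       : ∀ x → x ∧ 𝟙 ≡ x
    nontrivial : ¬ (𝟘 ≡ 𝟙)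

  _≤_ : Carrier → Carrier → Set a
  x ≤ y = x ∧ y ≡ x

  _⁺ : Carrier → Pred Carrier a
  (x ⁺) y = (x ∨ y ≡ 𝟙) × (x ∧ y ≡ 𝟘)

  _⇒_ : Carrier → Carrier → Pred Carrier a
  (x ⇒ y) z = Σ Carrier λ w → (x ⁺) w × (z ≡ w ∨ (x ∧ y))

  IsModular : Set a
  IsModular = ∀ x y z → x ≤ z → x ∨ (y ∧ z) ≡ (x ∨ y) ∧ z

  IsComplemented : Set a
  IsComplemented = ∀ x → ∃ λ y → (x ⁺) y

  IsDeductiveSystem : ∀ {ℓ} → Pred Carrier ℓ → Set (a ⊔ ℓ)
  IsDeductiveSystem D =
    D 𝟙 × (∀ x y → D x → (x ⇒ y) ⊆ D → D y)

  Θ : ∀ {ℓ} → Pred Carrier ℓ → Rel Carrier (a ⊔ ℓ)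
  Θ D x y = ((x ⇒ y) ⊆ D) × ((y ⇒ x) ⊆ D)

  record IsMeetCongruence {ℓ} (Φ : Rel Carrier ℓ) : Set (a ⊔ ℓ) where
    field
      isEquivalence : IsEquivalence Φ
      ∧-cong : ∀ {x y u v} → Φ x y → Φ u v → Φ (x ∧ u) (y ∧ v)

  [𝟙]_ : ∀ {ℓ} → Rel Carrier ℓ → Pred Carrier ℓ
  ([𝟙] Φ) x = Φ 𝟙 x

-- For a complement c of x, modularity gives x ∧ (c ∨ (x ∧ y)) = x ∧ y. So if the element
-- c ∨ (x ∧ y) of x → y is Φ-related to 1, meeting with x yields x Φ x ∧ y. For (i), x Φ 1
-- then gives x ∧ y Φ 1, and [1]Φ is upward closed; for (ii), x Φ x ∧ y Φ y.
module Submission where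

open import Defs
open import Data.Product using (_×_; _,_)
open import Relation.Unary using (_⊆_)
open import Relation.Binary using (Rel; IsEquivalence) renaming (_⇒_ to _⊆₂_)
open import Relation.Binary.PropositionalEquality
  using (_≡_; refl; sym; trans; cong; subst; module ≡-Reasoning)
open import Algebra.Lattice.Bundles using (Lattice)
import Algebra.Lattice.Properties.Lattice as LatticeProperties

module _ {a} (L : BoundedLattice a) where
  open BoundedLattice L

  lattice : Lattice a a
  lattice = record { isLattice = isLattice }

  open Lattice lattice using (∧-comm; ∧-assoc; ∨-comm)
  open LatticeProperties lattice using (∧-idem)

  x∧y≤x : ∀ x y → (x ∧ y) ≤ x
  x∧y≤x x y = trans (∧-comm (x ∧ y) x) (trans (sym (∧-assoc x x y)) (cong (_∧ y) (∧-idem x)))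

  x∧y≤y : ∀ x y → (x ∧ y) ≤ y
  x∧y≤y x y = trans (∧-assoc x y y) (cong (x ∧_) (∧-idem y))

  ∧-⇒ : IsModular → ∀ {x y z} → (x ⇒ y) z → x ∧ z ≡ x ∧ y
  ∧-⇒ modular {x} {y} (c , (_ , x∧c≡𝟘) , refl) = begin
    x ∧ (c ∨ x ∧ y)    ≡⟨ ∧-comm x _ ⟩
    (c ∨ x ∧ y) ∧ x    ≡⟨ cong (_∧ x) (∨-comm c (x ∧ y)) ⟩
    (x ∧ y ∨ c) ∧ x    ≡⟨ sym (modular (x ∧ y) c x (x∧y≤x x y)) ⟩
    x ∧ y ∨ c ∧ x      ≡⟨ cong (x ∧ y ∨_) (trans (∧-comm c x) x∧c≡𝟘) ⟩
    x ∧ y ∨ 𝟘          ≡⟨ ∨-𝟘 (x ∧ y) ⟩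
    x ∧ y              ∎
    where open ≡-Reasoning

  module _ {ℓ} {Φ : Rel Carrier ℓ} (congruence : IsMeetCongruence Φ) where
    open IsMeetCongruence congruence
    open IsEquivalence isEquivalence renaming (refl to Φ-refl; sym to Φ-sym; trans to Φ-trans)

    [𝟙]-∧ : ∀ x {z} → ([𝟙] Φ) z → Φ x (x ∧ z)
    [𝟙]-∧ x 𝟙Φz = subst (λ w → Φ w (x ∧ _)) (∧-𝟙 x) (∧-cong (Φ-refl {x}) 𝟙Φz)

    [𝟙]-upwardClosed : ∀ {x y} → x ≤ y → ([𝟙] Φ) x → ([𝟙] Φ) y
    [𝟙]-upwardClosed {x} {y} x≤y 𝟙Φx =
      Φ-trans 𝟙Φx (Φ-sym (subst (Φ y) (trans (∧-comm y x) x≤y) ([𝟙]-∧ y 𝟙Φx)))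

    module _ (modular : IsModular) (complemented : IsComplemented) where

      ⇒⊆[𝟙]⇒Φ∧ : ∀ {x y} → (x ⇒ y) ⊆ ([𝟙] Φ) → Φ x (x ∧ y)
      ⇒⊆[𝟙]⇒Φ∧ {x} {y} x⇒y⊆[𝟙] with complemented x
      ... | c , c∈x⁺ =
        subst (Φ x) (∧-⇒ modular c∨x∧y∈x⇒y) ([𝟙]-∧ x (x⇒y⊆[𝟙] c∨x∧y∈x⇒y))
        where
        c∨x∧y∈x⇒y : (x ⇒ y) (c ∨ x ∧ y)
        c∨x∧y∈x⇒y = c , c∈x⁺ , refl

      [𝟙]-isDeductiveSystem : IsDeductiveSystem ([𝟙] Φ)
      [𝟙]-isDeductiveSystem = Φ-refl , λ x y 𝟙Φx x⇒y⊆[𝟙] →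
        [𝟙]-upwardClosed (x∧y≤y x y) (Φ-trans 𝟙Φx (⇒⊆[𝟙]⇒Φ∧ x⇒y⊆[𝟙]))

      Θ[𝟙]⊆Φ : Θ ([𝟙] Φ) ⊆₂ Φ
      Θ[𝟙]⊆Φ {x} {y} (x⇒y⊆[𝟙] , y⇒x⊆[𝟙]) =
        Φ-trans (⇒⊆[𝟙]⇒Φ∧ x⇒y⊆[𝟙]) (subst (λ w → Φ w y) (∧-comm y x) (Φ-sym (⇒⊆[𝟙]⇒Φ∧ y⇒x⊆[𝟙])))

proposition5p6 : ∀ {a ℓ} (L : BoundedLattice a) → let open BoundedLattice L in
    IsModular → IsComplemented →
    (Φ : Rel Carrier ℓ) → IsMeetCongruence Φ →
    IsDeductiveSystem ([𝟙] Φ) × (Θ ([𝟙] Φ) ⊆₂ Φ)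
proposition5p6 L modular complemented Φ congruence =
  [𝟙]-isDeductiveSystem L congruence modular complemented ,
  Θ[𝟙]⊆Φ L congruence modular complemented
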